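{- If $(P,\mathcal{L})$ is a linear system with $\Delta(P,\mathcal{L})=2$, then $$\lceil \nu_2/2\rceil\leq \tau\leq \nu_2-1,$$ where $\tau=\tau(P,\mathcal{L})$ and $\nu_2=\nu_2(P,\mathcal{L})$.
   Context: A linear system is a pair $(P,\mathcal{L})$ where $P$ is a finite set (points) and $\mathcal{L}$ is a family of subsets of $P$ (lines) such that $|l\cap l'|\leq 1$ for all distinct $l,l'\in\mathcal{L}$. The degree of a point $p$ is the number of lines containing $p$, and $\Delta(P,\mathcal{L})$ is the maximum degree over all points. A transversal is a set $T\subseteq P$ meeting every line; $\tau(P,\mathcal{L})$ is the minimum size of a transversal. A 2-packing is a set $R\subseteq\mathcal{L}$ such that no three lines of $R$ have a common point; $\nu_2(P,\mathcal{L})$ is the maximum size of a 2-packing. -}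

module Defs where

open import Data.Nat using (ℕ; _≤_)
open import Data.Fin using (Fin)
open import Data.Fin.Subset using (Subset; _∈_; _∩_; ∣_∣)
open import Data.Vec using (tabulate; lookup)
open import Data.Product using (_×_; ∃)
open import Relation.Binary.PropositionalEquality using (_≡_; _≢_)
open import Relation.Nullary using (¬_)

Lines : ℕ → ℕ → Set
Lines n m = Fin m → Subset n

-- (P, L) is a linear system: the lines form a set (the indexing is
-- injective) and distinct lines meet in at most one point.
IsLinearSystem : ∀ {n m} → Lines n m → Set
IsLinearSystem {n} {m} L =
  (∀ (i j : Fin m) → L i ≡ L j → i ≡ j) ×
  (∀ (i j : Fin m) → i ≢ j → ∣ L i ∩ L j ∣ ≤ 1)

linesThrough : ∀ {n m} → Lines n m → Fin n → Subset m
linesThrough L p = tabulate (λ i → lookup (L i) p)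

degree : ∀ {n m} → Lines n m → Fin n → ℕ
degree L p = ∣ linesThrough L p ∣

MaxDegree : ∀ {n m} → Lines n m → ℕ → Set
MaxDegree {n} L d = (∀ (p : Fin n) → degree L p ≤ d) × ∃ (λ (p : Fin n) → degree L p ≡ d)

IsTransversal : ∀ {n m} → Lines n m → Subset n → Set
IsTransversal {n} {m} L T = ∀ (l : Fin m) → ∃ (λ (p : Fin n) → p ∈ T × p ∈ L l)

IsTau : ∀ {n m} → Lines n m → ℕ → Set
IsTau {n} L t =
  ∃ (λ (T : Subset n) → IsTransversal L T × ∣ T ∣ ≡ t) ×
  (∀ (T : Subset n) → IsTransversal L T → t ≤ ∣ T ∣)

IsTwoPacking : ∀ {n m} → Lines n m → Subset m → Set
IsTwoPacking {n} {m} L R =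
  ∀ (i j k : Fin m) → i ∈ R → j ∈ R → k ∈ R → i ≢ j → i ≢ k → j ≢ k →
  ∀ (p : Fin n) → ¬ (p ∈ L i × p ∈ L j × p ∈ L k)

IsNu2 : ∀ {n m} → Lines n m → ℕ → Set
IsNu2 {n} {m} L v =
  ∃ (λ (R : Subset m) → IsTwoPacking L R × ∣ R ∣ ≡ v) ×
  (∀ (R : Subset m) → IsTwoPacking L R → ∣ R ∣ ≤ v)

-- Since every point lies on at most two lines, no three lines share a point:
-- the set of all lines is a 2-packing, so ν₂ is the number m of lines.
-- Each point of a transversal covers at most two lines, so m ≤ 2τ.
-- A point p of degree 2, together with one point on each of the m − 2 lines
-- missing p, is a transversal, so τ ≤ m − 1.
module Submission where

open import Defs
open import Data.Nat using (ℕ; zero; suc; _+_; _*_; _≤_; _∸_; ⌈_/2⌉; z≤n; s≤s)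
open import Data.Nat.Properties
open import Data.Bool using (Bool; true; false)
open import Data.Fin using (Fin; zero; suc)
open import Data.Fin.Subset
  using (Subset; _∈_; _-_; _∪_; ∁; ⁅_⁆; ⊤; ⊥; ∣_∣; Nonempty; inside)
open import Data.Fin.Subset.Properties
open import Data.Vec using ([]; _∷_; lookup; here; there)
open import Data.Vec.Properties using ([]=⇒lookup; lookup⇒[]=; lookup∘tabulate)
open import Data.Vec.Functional using (Vector)
open import Data.Product using (_×_; _,_; proj₁; proj₂; map₂; ∃)
open import Data.Sum using (inj₁; inj₂)
open import Function using (_∘_)
open import Relation.Binary.PropositionalEquality
open import Relation.Nullary using (yes; no)
open import Algebra.Properties.Semiring.Sum +-*-semiring
  using (sum; sum-syntax; sum-cong-≗; sum-remove; ∑-comm; *-distribˡ-sum; *-distribʳ-sum)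

χ : Bool → ℕ
χ true  = 1
χ false = 0

∑-mono-≤ : ∀ {k} {f g : Vector ℕ k} → (∀ i → f i ≤ g i) → sum f ≤ sum g
∑-mono-≤ {zero}  f≤g = z≤n
∑-mono-≤ {suc k} f≤g = +-mono-≤ (f≤g zero) (∑-mono-≤ (f≤g ∘ suc))

∑-const-1 : ∀ k → ∑[ i < k ] 1 ≡ k
∑-const-1 zero    = refl
∑-const-1 (suc k) = cong suc (∑-const-1 k)

≤-sum : ∀ {k} (f : Vector ℕ k) i → f i ≤ sum f
≤-sum {suc k} f i = subst (f i ≤_) (sym (sum-remove {i = i} f)) (m≤m+n (f i) _)

∣p∣≡∑χ : ∀ {n} (p : Subset n) → ∣ p ∣ ≡ ∑[ i < n ] χ (lookup p i)
∣p∣≡∑χ []          = refl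
∣p∣≡∑χ (true ∷ p)  = cong suc (∣p∣≡∑χ p)
∣p∣≡∑χ (false ∷ p) = ∣p∣≡∑χ p

∣p∪q∣≤∣p∣+∣q∣ : ∀ {n} (p q : Subset n) → ∣ p ∪ q ∣ ≤ ∣ p ∣ + ∣ q ∣
∣p∪q∣≤∣p∣+∣q∣ []          []          = z≤n
∣p∪q∣≤∣p∣+∣q∣ (true ∷ p)  (x ∷ q)     =
  s≤s (≤-trans (∣p∪q∣≤∣p∣+∣q∣ p q) (+-monoʳ-≤ ∣ p ∣ (∣p∣≤∣x∷p∣ x q)))
∣p∪q∣≤∣p∣+∣q∣ (false ∷ p) (true ∷ q)  =
  subst (suc ∣ p ∪ q ∣ ≤_) (sym (+-suc ∣ p ∣ ∣ q ∣)) (s≤s (∣p∪q∣≤∣p∣+∣q∣ p q))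
∣p∪q∣≤∣p∣+∣q∣ (false ∷ p) (false ∷ q) = ∣p∪q∣≤∣p∣+∣q∣ p q

x∈p∧y∈p∧z∈p⇒3≤∣p∣ : ∀ {n} {p : Subset n} {x y z} → x ∈ p → y ∈ p → z ∈ p →
                    x ≢ y → x ≢ z → y ≢ z → 3 ≤ ∣ p ∣
x∈p∧y∈p∧z∈p⇒3≤∣p∣ {p = p} {x} {y} {z} x∈p y∈p z∈p x≢y x≢z y≢z =
  ≤-trans (s≤s (s≤s (s≤s z≤n)))
    (≤-trans (s≤s (s≤s (x∈p⇒∣p-x∣<∣p∣ z∈p-x-y)))
      (≤-trans (s≤s (x∈p⇒∣p-x∣<∣p∣ y∈p-x)) (x∈p⇒∣p-x∣<∣p∣ x∈p)))
  where
  y∈p-x : y ∈ p - x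
  y∈p-x = x∈p∧x≢y⇒x∈p-y y∈p (x≢y ∘ sym)
  z∈p-x-y : z ∈ p - x - y
  z∈p-x-y = x∈p∧x≢y⇒x∈p-y (x∈p∧x≢y⇒x∈p-y z∈p (x≢z ∘ sym)) (y≢z ∘ sym)

image : ∀ {m n} → (Fin m → Fin n) → Subset m → Subset n
image f []          = ⊥
image f (true ∷ p)  = ⁅ f zero ⁆ ∪ image (f ∘ suc) p
image f (false ∷ p) = image (f ∘ suc) p

∣image∣≤∣p∣ : ∀ {m n} (f : Fin m → Fin n) (p : Subset m) → ∣ image f p ∣ ≤ ∣ p ∣
∣image∣≤∣p∣ {n = n} f [] = ≤-reflexive (∣⊥∣≡0 n)
∣image∣≤∣p∣ f (true ∷ p)  = ≤-trans (∣p∪q∣≤∣p∣+∣q∣ ⁅ f zero ⁆ _)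
  (subst (_≤ suc ∣ p ∣) (cong (_+ ∣ image (f ∘ suc) p ∣) (sym (∣⁅x⁆∣≡1 (f zero))))
    (s≤s (∣image∣≤∣p∣ (f ∘ suc) p)))
∣image∣≤∣p∣ f (false ∷ p) = ∣image∣≤∣p∣ (f ∘ suc) p

x∈p⇒f[x]∈image : ∀ {m n} (f : Fin m → Fin n) {p : Subset m} {x} → x ∈ p → f x ∈ image f p
x∈p⇒f[x]∈image f {true ∷ p}  here         = x∈p∪q⁺ (inj₁ (x∈⁅x⁆ (f zero)))
x∈p⇒f[x]∈image f {true ∷ p}  (there x∈p) = x∈p∪q⁺ (inj₂ (x∈p⇒f[x]∈image (f ∘ suc) x∈p))
x∈p⇒f[x]∈image f {false ∷ p} (there x∈p) = x∈p⇒f[x]∈image (f ∘ suc) x∈p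

module _ {n m : ℕ} (L : Lines n m) where

  linesThrough⁺ : ∀ {p l} → p ∈ L l → l ∈ linesThrough L p
  linesThrough⁺ {p} {l} p∈l = lookup⇒[]= l _ (trans (lookup∘tabulate _ l) ([]=⇒lookup p∈l))

  linesThrough⁻ : ∀ {p l} → l ∈ linesThrough L p → p ∈ L l
  linesThrough⁻ {p} {l} l∈ = lookup⇒[]= p (L l) (trans (sym (lookup∘tabulate _ l)) ([]=⇒lookup l∈))

  degree≡∑ : ∀ p → degree L p ≡ ∑[ l < m ] χ (lookup (L l) p)
  degree≡∑ p =
    trans (∣p∣≡∑χ (linesThrough L p)) (sum-cong-≗ (cong χ ∘ lookup∘tabulate (λ l → lookup (L l) p)))

  degree≤2⇒isTwoPacking : (∀ p → degree L p ≤ 2) → ∀ R → IsTwoPacking L R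
  degree≤2⇒isTwoPacking deg≤2 R i j k _ _ _ i≢j i≢k j≢k p (p∈i , p∈j , p∈k) =
    <⇒≱ (s≤s (deg≤2 p))
      (x∈p∧y∈p∧z∈p⇒3≤∣p∣ (linesThrough⁺ p∈i) (linesThrough⁺ p∈j) (linesThrough⁺ p∈k)
         i≢j i≢k j≢k)

  degree≤2⇒ν₂≡m : (∀ p → degree L p ≤ 2) → ∀ {v} → IsNu2 L v → v ≡ m
  degree≤2⇒ν₂≡m deg≤2 ((R , _ , refl) , maximal) =
    ≤-antisym (∣p∣≤n R)
      (subst (_≤ ∣ R ∣) (∣⊤∣≡n m) (maximal ⊤ (degree≤2⇒isTwoPacking deg≤2 ⊤)))

  m≤d*∣transversal∣ : ∀ {d} → (∀ p → degree L p ≤ d) →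
                      ∀ {T} → IsTransversal L T → m ≤ d * ∣ T ∣
  m≤d*∣transversal∣ {d} deg≤d {T} isT = begin
    m                                                 ≡⟨ ∑-const-1 m ⟨
    ∑[ l < m ] 1                                      ≤⟨ ∑-mono-≤ meets ⟩
    ∑[ l < m ] ∑[ q < n ] incident l q                ≡⟨ ∑-comm incident ⟩
    ∑[ q < n ] ∑[ l < m ] incident l q
      ≡⟨ sum-cong-≗ (λ q → *-distribˡ-sum (χ (lookup T q)) (λ l → χ (lookup (L l) q))) ⟨
    ∑[ q < n ] (χ (lookup T q) * ∑[ l < m ] χ (lookup (L l) q))
      ≡⟨ sum-cong-≗ (λ q → cong (χ (lookup T q) *_) (degree≡∑ q)) ⟨
    ∑[ q < n ] (χ (lookup T q) * degree L q)
      ≤⟨ ∑-mono-≤ (λ q → *-monoʳ-≤ (χ (lookup T q)) (deg≤d q)) ⟩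
    ∑[ q < n ] (χ (lookup T q) * d)                   ≡⟨ *-distribʳ-sum d (χ ∘ lookup T) ⟨
    (∑[ q < n ] χ (lookup T q)) * d                   ≡⟨ cong (_* d) (∣p∣≡∑χ T) ⟨
    ∣ T ∣ * d                                         ≡⟨ *-comm ∣ T ∣ d ⟩
    d * ∣ T ∣                                         ∎
    where
    open ≤-Reasoning
    incident : Fin m → Fin n → ℕ
    incident l q = χ (lookup T q) * χ (lookup (L l) q)
    meets : ∀ l → 1 ≤ ∑[ q < n ] incident l q
    meets l with q , q∈T , q∈l ← isT l =
      subst (_≤ sum (incident l)) (cong₂ (λ a b → χ a * χ b) ([]=⇒lookup q∈T) ([]=⇒lookup q∈l))
        (≤-sum (incident l) q)

  ∃transversal-of-size≤1+m∸degree : (∀ l → Nonempty (L l)) → ∀ p →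
    ∃ λ T → IsTransversal L T × ∣ T ∣ ≤ suc (m ∸ degree L p)
  ∃transversal-of-size≤1+m∸degree nonempty p = T , isT , size
    where
    domain : Subset (suc m)
    domain = inside ∷ ∁ (linesThrough L p)
    choice : Fin (suc m) → Fin n
    choice zero    = p
    choice (suc l) = proj₁ (nonempty l)
    T : Subset n
    T = image choice domain
    isT : IsTransversal L T
    isT l with p ∈? L l
    ... | yes p∈l = p , x∈p⇒f[x]∈image choice {domain} here , p∈l
    ... | no  p∉l = proj₁ (nonempty l)
                  , x∈p⇒f[x]∈image choice {domain}
                      (there (x∉p⇒x∈∁p (p∉l ∘ linesThrough⁻)))
                  , proj₂ (nonempty l)
    size : ∣ T ∣ ≤ suc (m ∸ degree L p)
    size = subst (∣ T ∣ ≤_) (cong suc (∣∁p∣≡n∸∣p∣ (linesThrough L p))) (∣image∣≤∣p∣ choice domain)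

proposition2p1 : ∀ (n m : ℕ) (L : Lines n m) → IsLinearSystem L → MaxDegree L 2 →
    ∀ (t v : ℕ) → IsTau L t → IsNu2 L v →
    (⌈ v /2⌉ ≤ t) × (t ≤ v ∸ 1)
proposition2p1 n m L _ (deg≤2 , p , deg-p≡2) t v ((T₀ , T₀-transversal , refl) , τ-minimal) ν₂ =
  lower , upper
  where
  open ≤-Reasoning
  v≡m : v ≡ m
  v≡m = degree≤2⇒ν₂≡m L deg≤2 ν₂
  2≤m : 2 ≤ m
  2≤m = subst (_≤ m) deg-p≡2 (∣p∣≤n (linesThrough L p))
  lower : ⌈ v /2⌉ ≤ t
  lower = begin
    ⌈ v /2⌉      ≡⟨ cong ⌈_/2⌉ v≡m ⟩
    ⌈ m /2⌉      ≤⟨ ⌈n/2⌉-mono (m≤d*∣transversal∣ L deg≤2 T₀-transversal) ⟩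
    ⌈ 2 * t /2⌉  ≡⟨ cong (λ s → ⌈ t + s /2⌉) (+-identityʳ t) ⟩
    ⌈ t + t /2⌉  ≡⟨ n≡⌈n+n/2⌉ t ⟨
    t            ∎
  upper : t ≤ v ∸ 1
  upper with T , T-transversal , ∣T∣≤
             ← ∃transversal-of-size≤1+m∸degree L (map₂ proj₂ ∘ T₀-transversal) p =
    begin
      t                     ≤⟨ τ-minimal T T-transversal ⟩
      ∣ T ∣                 ≤⟨ ∣T∣≤ ⟩
      suc (m ∸ degree L p)  ≡⟨ cong (λ d → suc (m ∸ d)) deg-p≡2 ⟩
      suc (m ∸ 2)           ≡⟨ +-∸-assoc 1 2≤m ⟨
      m ∸ 1                 ≡⟨ cong (_∸ 1) v≡m ⟨
      v ∸ 1                 ∎
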